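{- Let $\mathcal C$ be a symmetric monoidal closed category with zero morphisms $0$ that are absorbing for $\otimes$ ($X\otimes 0=0$, $0\otimes Y=0$). Then $\mathcal C$ is representable if and only if it has a summation object $(D,(\iota_i)_{i\in\mathbb N},\Delta)$ such that every hom-set $\mathcal C(X,Y)$ has a PCM structure in which: (1) for every $n\ge1$, a family $(f_{i_1,\dots,i_n})_{i_1,\dots,i_n\in\mathbb N}$ of morphisms $X\to Y$ is summable if and only if there exists $h:X\otimes D^{\otimes n}\to Y$ with $h\circ(X\otimes\iota_{i_n}\otimes\cdots\otimes\iota_{i_1})\circ(\rho^n_X)^{ -1}=f_{i_1,\dots,i_n}$ for all indices; (2) in that case $\sum_{i_1,\dots,i_n}f_{i_1,\dots,i_n}=h\circ(X\otimes\Delta\otimes\cdots\otimes\Delta)\circ(\rho^n_X)^{ -1}$; (3) the sum of the empty family is the zero morphism.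
   Context: PCM: a nonempty set with a partial sum on countably indexed families ("summable" families) satisfying (Unary) singletons $(x)$ are summable with sum $x$, and (WPA) for summable $(x_a)_{a\in A}$ and a countable partition $\{A_i\}_{i\in I}$ of $A$ (parts possibly empty), each $(x_a)_{a\in A_i}$ is summable and $(\sum_{a\in A_i}x_a)_i$ is summable with sum $\sum_{a\in A}x_a$. A summation object is an object $D$ with jointly epic morphisms $\iota_i:1\to D$ ($i\in\mathbb N$, the basis) and a morphism $\Delta:1\to D$ (the diagonal). $\rho_X:X\otimes1\to X$ is the right unitor and $(\rho^n_X)^{ -1}:X\to X\otimes 1^{\otimes n}$ its iterate. Define natural transformations $\pi_i=\mathrm{ev}\circ((D\multimap X)\otimes\iota_i)\circ\rho^{ -1}$ and $\Sigma=\mathrm{ev}\circ((D\multimap X)\otimes\Delta)\circ\rho^{ -1}$ from $D\multimap X$ to $X$. A summability structure on $\mathcal C$ is $(S,(\pi_i),\Sigma,0)$ with $S$ an endofunctor, $\pi_i,\Sigma:S\Rightarrow\mathrm{Id}$ natural, $0$ zero morphisms, $\pi_i$ jointly monic, and a PCM structure on each $\mathcal C(X,Y)$ such that for every $n\ge1$ a family $(f_{i_1,\dots,i_n})$ is summable iff some $f:X\to S^nY$ has $\pi_{i_1}\circ\cdots\circ\pi_{i_n}\circ f=f_{i_1,\dots,i_n}$, the sum then being $\Sigma^{\circ n}\circ f$, and the empty sum is $0$. $\mathcal C$ is representable if it has a summation object $D$ such that $(D\multimap -,(\pi_i),\Sigma,0)$ is a summability structure. -}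

module Defs where

open import Level using (Level; _⊔_) renaming (suc to lsuc; zero to lzero)
open import Data.Nat using (ℕ; zero; suc)
open import Data.Vec using (Vec; []; _∷_)
open import Data.Product using (Σ; Σ-syntax; _×_; _,_; proj₁)
open import Relation.Nullary using (¬_)
open import Relation.Binary.PropositionalEquality using (_≡_)
open import Function.Definitions using (Injective)
open import Function.Bundles using (_⇔_)

record SMCC (o h : Level) : Set (lsuc (o ⊔ h)) where
  infixr 9 _∘_
  infixr 10 _⊗₀_ _⊗₁_
  infixr 8 _⊸_
  field
    Obj  : Set o
    _⇒_  : Obj → Obj → Set h
    id   : ∀ {X} → X ⇒ X
    _∘_  : ∀ {X Y Z} → Y ⇒ Z → X ⇒ Y → X ⇒ Z
    identityˡ : ∀ {X Y} (f : X ⇒ Y) → id ∘ f ≡ f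
    identityʳ : ∀ {X Y} (f : X ⇒ Y) → f ∘ id ≡ f
    assoc     : ∀ {W X Y Z} (f : Y ⇒ Z) (g : X ⇒ Y) (k : W ⇒ X) →
                (f ∘ g) ∘ k ≡ f ∘ (g ∘ k)
    _⊗₀_ : Obj → Obj → Obj
    _⊗₁_ : ∀ {X X′ Y Y′} → X ⇒ X′ → Y ⇒ Y′ → (X ⊗₀ Y) ⇒ (X′ ⊗₀ Y′)
    ⊗-id : ∀ {X Y} → (id {X} ⊗₁ id {Y}) ≡ id
    ⊗-∘  : ∀ {X Y Z X′ Y′ Z′} (f : Y ⇒ Z) (g : X ⇒ Y) (f′ : Y′ ⇒ Z′) (g′ : X′ ⇒ Y′) →
           ((f ∘ g) ⊗₁ (f′ ∘ g′)) ≡ (f ⊗₁ f′) ∘ (g ⊗₁ g′)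
    𝟙 : Obj
    α    : ∀ {X Y Z} → ((X ⊗₀ Y) ⊗₀ Z) ⇒ (X ⊗₀ (Y ⊗₀ Z))
    α⁻¹  : ∀ {X Y Z} → (X ⊗₀ (Y ⊗₀ Z)) ⇒ ((X ⊗₀ Y) ⊗₀ Z)
    α-isoˡ : ∀ {X Y Z} → α⁻¹ {X} {Y} {Z} ∘ α ≡ id
    α-isoʳ : ∀ {X Y Z} → α {X} {Y} {Z} ∘ α⁻¹ ≡ id
    α-nat  : ∀ {X X′ Y Y′ Z Z′} (f : X ⇒ X′) (g : Y ⇒ Y′) (k : Z ⇒ Z′) →
             α ∘ ((f ⊗₁ g) ⊗₁ k) ≡ (f ⊗₁ (g ⊗₁ k)) ∘ α
    lam    : ∀ {X} → (𝟙 ⊗₀ X) ⇒ X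
    lam⁻¹  : ∀ {X} → X ⇒ (𝟙 ⊗₀ X)
    lam-isoˡ : ∀ {X} → lam⁻¹ {X} ∘ lam ≡ id
    lam-isoʳ : ∀ {X} → lam {X} ∘ lam⁻¹ ≡ id
    lam-nat  : ∀ {X Y} (f : X ⇒ Y) → lam ∘ (id ⊗₁ f) ≡ f ∘ lam
    ρ      : ∀ {X} → (X ⊗₀ 𝟙) ⇒ X
    ρ⁻¹    : ∀ {X} → X ⇒ (X ⊗₀ 𝟙)
    ρ-isoˡ : ∀ {X} → ρ⁻¹ {X} ∘ ρ ≡ id
    ρ-isoʳ : ∀ {X} → ρ {X} ∘ ρ⁻¹ ≡ id
    ρ-nat  : ∀ {X Y} (f : X ⇒ Y) → ρ ∘ (f ⊗₁ id) ≡ f ∘ ρ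
    σ      : ∀ {X Y} → (X ⊗₀ Y) ⇒ (Y ⊗₀ X)
    σ-nat  : ∀ {X X′ Y Y′} (f : X ⇒ X′) (g : Y ⇒ Y′) → σ ∘ (f ⊗₁ g) ≡ (g ⊗₁ f) ∘ σ
    σ-inv  : ∀ {X Y} → σ {Y} {X} ∘ σ {X} {Y} ≡ id
    triangle : ∀ {X Y} → (id {X} ⊗₁ lam {Y}) ∘ α ≡ (ρ ⊗₁ id)
    pentagon : ∀ {W X Y Z} →
               (id {W} ⊗₁ α {X} {Y} {Z}) ∘ α ∘ (α ⊗₁ id) ≡ α ∘ α
    hexagon  : ∀ {X Y Z} →
               (id {Y} ⊗₁ σ {X} {Z}) ∘ α ∘ (σ ⊗₁ id) ≡ α ∘ σ ∘ α
    _⊸_   : Obj → Obj → Obj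
    ev    : ∀ {A B} → ((A ⊸ B) ⊗₀ A) ⇒ B
    curry : ∀ {C A B} → (C ⊗₀ A) ⇒ B → C ⇒ (A ⊸ B)
    curry-β : ∀ {C A B} (f : (C ⊗₀ A) ⇒ B) → ev ∘ (curry f ⊗₁ id) ≡ f
    curry-η : ∀ {C A B} (g : C ⇒ (A ⊸ B)) → curry (ev ∘ (g ⊗₁ id)) ≡ g

record ZeroMorphisms {o h} (C : SMCC o h) : Set (o ⊔ h) where
  open SMCC C
  field
    0m : ∀ {X Y} → X ⇒ Y
    0m-∘ : ∀ {X Y Z} (f : Y ⇒ Z) → f ∘ 0m {X} {Y} ≡ 0m
    ∘-0m : ∀ {X Y Z} (g : X ⇒ Y) → 0m {Y} {Z} ∘ g ≡ 0m

Absorbing : ∀ {o h} (C : SMCC o h) → ZeroMorphisms C → Set (o ⊔ h)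
Absorbing C Z =
  (∀ {X Y Y′} → (id {X} ⊗₁ 0m {Y} {Y′}) ≡ 0m {X ⊗₀ Y} {X ⊗₀ Y′}) ×
  (∀ {X X′ Y} → (0m {X} {X′} ⊗₁ id {Y}) ≡ 0m {X ⊗₀ Y} {X′ ⊗₀ Y})
  where open SMCC C; open ZeroMorphisms Z

Countable : Set → Set
Countable A = Σ[ e ∈ (A → ℕ) ] Injective _≡_ _≡_ e

Part : {A I : Set} → (A → I) → I → Set
Part {A} p i = Σ[ a ∈ A ] (p a ≡ i)

record PCM {h} (M : Set h) : Set (lsuc h) where
  field
    inhabited : M
    Sums : (A : Set) → (A → M) → M → Set h
    sums-countable  : ∀ {A f s} → Sums A f s → Countable A
    sums-functional : ∀ {A f s t} → Sums A f s → Sums A f t → s ≡ t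
    unary : ∀ {A : Set} (a : A) → (∀ b → b ≡ a) → (f : A → M) → Sums A f (f a)
    wpa   : ∀ {A I : Set} {f : A → M} {s : M} → Sums A f s → Countable I →
            (p : A → I) →
            Σ[ g ∈ (I → M) ]
              ((∀ i → Sums (Part p i) (λ x → f (proj₁ x)) (g i)) × Sums I g s)

  Summable : (A : Set) → (A → M) → Set h
  Summable A f = Σ[ s ∈ M ] Sums A f s

module _ {o h} (C : SMCC o h) (Z : ZeroMorphisms C) where
  open SMCC C
  open ZeroMorphisms Z

  iterObj : (Obj → Obj) → ℕ → Obj → Obj
  iterObj S zero Y = Y
  iterObj S (suc n) Y = iterObj S n (S Y)

  πs : (S : Obj → Obj) (π : ℕ → ∀ X → S X ⇒ X) →
       ∀ {n Y} → Vec ℕ n → iterObj S n Y ⇒ Y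
  πs S π [] = id
  πs S π {Y = Y} (i ∷ is) = π i Y ∘ πs S π {Y = S Y} is

  Σs : (S : Obj → Obj) (Σ′ : ∀ X → S X ⇒ X) → ∀ n {Y} → iterObj S n Y ⇒ Y
  Σs S Σ′ zero = id
  Σs S Σ′ (suc n) {Y} = Σ′ Y ∘ Σs S Σ′ n {S Y}

  record IsSummabilityStructure
      (S₀ : Obj → Obj) (S₁ : ∀ {X Y} → X ⇒ Y → S₀ X ⇒ S₀ Y)
      (π : ℕ → ∀ X → S₀ X ⇒ X) (Σ′ : ∀ X → S₀ X ⇒ X) : Set (lsuc (o ⊔ h)) where
    field
      S-id : ∀ {X} → S₁ (id {X}) ≡ id
      S-∘  : ∀ {X Y Z} (f : Y ⇒ Z) (g : X ⇒ Y) → S₁ (f ∘ g) ≡ S₁ f ∘ S₁ g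
      π-nat : ∀ i {X Y} (f : X ⇒ Y) → π i Y ∘ S₁ f ≡ f ∘ π i X
      Σ-nat : ∀ {X Y} (f : X ⇒ Y) → Σ′ Y ∘ S₁ f ≡ f ∘ Σ′ X
      π-jointly-monic : ∀ {X Y} (f g : X ⇒ S₀ Y) →
                        (∀ i → π i Y ∘ f ≡ π i Y ∘ g) → f ≡ g
      pcm : ∀ X Y → PCM (X ⇒ Y)
      summable-iff : ∀ n {X Y} (f : Vec ℕ (suc n) → X ⇒ Y) →
        PCM.Summable (pcm X Y) (Vec ℕ (suc n)) f ⇔
        (Σ[ g ∈ X ⇒ iterObj S₀ (suc n) Y ] (∀ is → πs S₀ π is ∘ g ≡ f is))
      sum-eq : ∀ n {X Y} (f : Vec ℕ (suc n) → X ⇒ Y) (g : X ⇒ iterObj S₀ (suc n) Y) →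
        (∀ is → πs S₀ π is ∘ g ≡ f is) →
        ∀ s → PCM.Sums (pcm X Y) (Vec ℕ (suc n)) f s → s ≡ Σs S₀ Σ′ (suc n) ∘ g
      empty-sum : ∀ {X Y} (A : Set) → ¬ A → (f : A → X ⇒ Y) →
        PCM.Sums (pcm X Y) A f 0m

  record SummationObject : Set (lsuc (o ⊔ h)) where
    field
      D : Obj
      ι : ℕ → 𝟙 ⇒ D
      ι-jointly-epic : ∀ {X} (f g : D ⇒ X) → (∀ i → f ∘ ι i ≡ g ∘ ι i) → f ≡ g
      Δ : 𝟙 ⇒ D

  module SumObj (SO : SummationObject) where
    open SummationObject SO

    D⊸₀ : Obj → Obj
    D⊸₀ X = D ⊸ X

    D⊸₁ : ∀ {X Y} → X ⇒ Y → D⊸₀ X ⇒ D⊸₀ Y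
    D⊸₁ f = curry (f ∘ ev)

    πD : ℕ → ∀ X → D⊸₀ X ⇒ X
    πD i X = ev ∘ (id ⊗₁ ι i) ∘ ρ⁻¹

    ΣD : ∀ X → D⊸₀ X ⇒ X
    ΣD X = ev ∘ (id ⊗₁ Δ) ∘ ρ⁻¹

    XD : Obj → ℕ → Obj
    XD X zero = X
    XD X (suc n) = XD X n ⊗₀ D

    X1 : Obj → ℕ → Obj
    X1 X zero = X
    X1 X (suc n) = X1 X n ⊗₀ 𝟙

    ρⁿ⁻¹ : ∀ {X} n → X ⇒ X1 X n
    ρⁿ⁻¹ zero = id
    ρⁿ⁻¹ (suc n) = ρ⁻¹ ∘ ρⁿ⁻¹ n

    -- X ⊗ ι_{iₙ} ⊗ ⋯ ⊗ ι_{i₁} for the vector (i₁ , … , iₙ)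
    ιs : ∀ {X n} → Vec ℕ n → X1 X n ⇒ XD X n
    ιs [] = id
    ιs (i ∷ is) = ιs is ⊗₁ ι i

    Δs : ∀ {X} n → X1 X n ⇒ XD X n
    Δs zero = id
    Δs (suc n) = Δs n ⊗₁ Δ

  Representable : Set (lsuc (o ⊔ h))
  Representable = Σ[ SO ∈ SummationObject ]
    IsSummabilityStructure (SumObj.D⊸₀ SO) (SumObj.D⊸₁ SO) (SumObj.πD SO) (SumObj.ΣD SO)

  HasTensorialSums : Set (lsuc (o ⊔ h))
  HasTensorialSums = Σ[ SO ∈ SummationObject ] Σ[ pcm ∈ (∀ X Y → PCM (X ⇒ Y)) ]
    ((∀ n {X Y} (f : Vec ℕ (suc n) → X ⇒ Y) →
        PCM.Summable (pcm X Y) (Vec ℕ (suc n)) f ⇔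
        (Σ[ k ∈ SumObj.XD SO X (suc n) ⇒ Y ]
           (∀ is → k ∘ SumObj.ιs SO is ∘ SumObj.ρⁿ⁻¹ SO (suc n) ≡ f is))) ×
     (∀ n {X Y} (f : Vec ℕ (suc n) → X ⇒ Y) (k : SumObj.XD SO X (suc n) ⇒ Y) →
        (∀ is → k ∘ SumObj.ιs SO is ∘ SumObj.ρⁿ⁻¹ SO (suc n) ≡ f is) →
        ∀ s → PCM.Sums (pcm X Y) (Vec ℕ (suc n)) f s →
        s ≡ k ∘ SumObj.Δs SO (suc n) ∘ SumObj.ρⁿ⁻¹ SO (suc n)) ×
     (∀ {X Y} (A : Set) → ¬ A → (f : A → X ⇒ Y) → PCM.Sums (pcm X Y) A f (ZeroMorphisms.0m Z)))

-- Uncurrying n times identifies morphisms X → D ⊸ (⋯ ⊸ (D ⊸ Y)) with morphisms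
-- X ⊗ D ⊗ ⋯ ⊗ D → Y, and under this bijection the projections π_{i₁} ∘ ⋯ ∘ π_{iₙ}
-- and the iterated sum Σⁿ of the functor D ⊸ - become precomposition with
-- (X ⊗ ι_{iₙ} ⊗ ⋯ ⊗ ι_{i₁}) ∘ (ρⁿ)⁻¹ and (X ⊗ Δ ⊗ ⋯ ⊗ Δ) ∘ (ρⁿ)⁻¹. So the summability
-- clauses of the two sides correspond. The remaining axioms of a summability
-- structure for D ⊸ - hold in any closed category: D ⊸ - is a functor, evaluation at
-- a point 1 → D is natural, and the evaluations at the ι_i are jointly monic because
-- the ι_i are jointly epic (transpose along the symmetry).
module Submission where

open import Level using (Level)
open import Function.Bundles using (_⇔_; mk⇔)
open import Function.Properties.Equivalence using () renaming (trans to ⇔-trans; sym to ⇔-sym)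
open import Data.Nat using (ℕ; zero; suc)
open import Data.Vec using (Vec; []; _∷_)
open import Data.Product using (Σ-syntax; _,_)
open import Relation.Binary.PropositionalEquality
open import Defs

module ClosedCategory {o h} (C : SMCC o h) where
  open SMCC C
  open ≡-Reasoning

  ∘-cancel-split-epiʳ : ∀ {A B Y} {a b : A ⇒ Y} {r : B ⇒ A} {s : A ⇒ B} →
                        r ∘ s ≡ id → a ∘ r ≡ b ∘ r → a ≡ b
  ∘-cancel-split-epiʳ {a = a} {b} {r} {s} r∘s≡id a∘r≡b∘r = begin
    a            ≡⟨ sym (identityʳ a) ⟩
    a ∘ id       ≡⟨ cong (a ∘_) (sym r∘s≡id) ⟩
    a ∘ (r ∘ s)  ≡⟨ sym (assoc a r s) ⟩
    (a ∘ r) ∘ s  ≡⟨ cong (_∘ s) a∘r≡b∘r ⟩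
    (b ∘ r) ∘ s  ≡⟨ assoc b r s ⟩
    b ∘ (r ∘ s)  ≡⟨ cong (b ∘_) r∘s≡id ⟩
    b ∘ id       ≡⟨ identityʳ b ⟩
    b            ∎

  id∘f≡f∘id∘id : ∀ {X Y} (f : X ⇒ Y) → id ∘ f ≡ f ∘ id ∘ id
  id∘f≡f∘id∘id f = trans (identityˡ f) (sym (trans (cong (f ∘_) (identityˡ id)) (identityʳ f)))

  ρ⁻¹-natural : ∀ {X Y} (f : X ⇒ Y) → ρ⁻¹ ∘ f ≡ (f ⊗₁ id) ∘ ρ⁻¹
  ρ⁻¹-natural f = ∘-cancel-split-epiʳ ρ-isoʳ (begin
    (ρ⁻¹ ∘ f) ∘ ρ                ≡⟨ assoc ρ⁻¹ f ρ ⟩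
    ρ⁻¹ ∘ (f ∘ ρ)                ≡⟨ cong (ρ⁻¹ ∘_) (sym (ρ-nat f)) ⟩
    ρ⁻¹ ∘ (ρ ∘ (f ⊗₁ id))        ≡⟨ sym (assoc ρ⁻¹ ρ (f ⊗₁ id)) ⟩
    (ρ⁻¹ ∘ ρ) ∘ (f ⊗₁ id)        ≡⟨ cong (_∘ (f ⊗₁ id)) ρ-isoˡ ⟩
    id ∘ (f ⊗₁ id)               ≡⟨ identityˡ (f ⊗₁ id) ⟩
    f ⊗₁ id                      ≡⟨ sym (identityʳ (f ⊗₁ id)) ⟩
    (f ⊗₁ id) ∘ id               ≡⟨ cong ((f ⊗₁ id) ∘_) (sym ρ-isoˡ) ⟩
    (f ⊗₁ id) ∘ (ρ⁻¹ ∘ ρ)        ≡⟨ sym (assoc (f ⊗₁ id) ρ⁻¹ ρ) ⟩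
    ((f ⊗₁ id) ∘ ρ⁻¹) ∘ ρ        ∎)

  serialize₁₂ : ∀ {A A′ B B′} (f : A ⇒ A′) (g : B ⇒ B′) → f ⊗₁ g ≡ (f ⊗₁ id) ∘ (id ⊗₁ g)
  serialize₁₂ f g = trans (cong₂ _⊗₁_ (sym (identityʳ f)) (sym (identityˡ g))) (⊗-∘ f id id g)

  serialize₂₁ : ∀ {A A′ B B′} (f : A ⇒ A′) (g : B ⇒ B′) → f ⊗₁ g ≡ (id ⊗₁ g) ∘ (f ⊗₁ id)
  serialize₂₁ f g = trans (cong₂ _⊗₁_ (sym (identityˡ f)) (sym (identityʳ g))) (⊗-∘ id f g id)

  ⊗₁id-∘ : ∀ {A B E F} (f : B ⇒ E) (a : A ⇒ B) → (f ∘ a) ⊗₁ id {F} ≡ (f ⊗₁ id) ∘ (a ⊗₁ id)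
  ⊗₁id-∘ f a = trans (cong ((f ∘ a) ⊗₁_) (sym (identityˡ id))) (⊗-∘ f a id id)

  ⊗-point-slide : ∀ {W X A Q} (a : X ⇒ A) (r : W ⇒ X) (p : 𝟙 ⇒ Q) →
                  ((a ∘ r) ⊗₁ id) ∘ (id ⊗₁ p) ∘ ρ⁻¹ ≡ (a ⊗₁ p) ∘ ρ⁻¹ ∘ r
  ⊗-point-slide a r p = begin
    ((a ∘ r) ⊗₁ id) ∘ (id ⊗₁ p) ∘ ρ⁻¹  ≡⟨ sym (assoc _ _ ρ⁻¹) ⟩
    (((a ∘ r) ⊗₁ id) ∘ (id ⊗₁ p)) ∘ ρ⁻¹ ≡⟨ cong (_∘ ρ⁻¹) (sym (serialize₁₂ (a ∘ r) p)) ⟩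
    ((a ∘ r) ⊗₁ p) ∘ ρ⁻¹               ≡⟨ cong (λ u → ((a ∘ r) ⊗₁ u) ∘ ρ⁻¹) (sym (identityʳ p)) ⟩
    ((a ∘ r) ⊗₁ (p ∘ id)) ∘ ρ⁻¹        ≡⟨ cong (_∘ ρ⁻¹) (⊗-∘ a r p id) ⟩
    ((a ⊗₁ p) ∘ (r ⊗₁ id)) ∘ ρ⁻¹       ≡⟨ assoc (a ⊗₁ p) _ ρ⁻¹ ⟩
    (a ⊗₁ p) ∘ (r ⊗₁ id) ∘ ρ⁻¹         ≡⟨ cong ((a ⊗₁ p) ∘_) (sym (ρ⁻¹-natural r)) ⟩
    (a ⊗₁ p) ∘ ρ⁻¹ ∘ r                 ∎

  uncurry : ∀ {X A B} → X ⇒ (A ⊸ B) → (X ⊗₀ A) ⇒ B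
  uncurry F = ev ∘ (F ⊗₁ id)

  uncurry-∘ : ∀ {W X A B} (F : X ⇒ (A ⊸ B)) (a : W ⇒ X) →
              uncurry (F ∘ a) ≡ uncurry F ∘ (a ⊗₁ id)
  uncurry-∘ F a = trans (cong (ev ∘_) (⊗₁id-∘ F a)) (sym (assoc ev (F ⊗₁ id) (a ⊗₁ id)))

  curry-∘ : ∀ {W X A B} (k : (X ⊗₀ A) ⇒ B) (a : W ⇒ X) → curry k ∘ a ≡ curry (k ∘ (a ⊗₁ id))
  curry-∘ k a = begin
    curry k ∘ a                        ≡⟨ sym (curry-η (curry k ∘ a)) ⟩
    curry (uncurry (curry k ∘ a))      ≡⟨ cong curry (uncurry-∘ (curry k) a) ⟩
    curry (uncurry (curry k) ∘ (a ⊗₁ id)) ≡⟨ cong (λ u → curry (u ∘ (a ⊗₁ id))) (curry-β k) ⟩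
    curry (k ∘ (a ⊗₁ id))              ∎

  curry-injective : ∀ {X A B} {k l : (X ⊗₀ A) ⇒ B} → curry k ≡ curry l → k ≡ l
  curry-injective {k = k} {l} eq =
    trans (sym (curry-β k)) (trans (cong uncurry eq) (curry-β l))

  uncurry-injective : ∀ {X A B} {F G : X ⇒ (A ⊸ B)} → uncurry F ≡ uncurry G → F ≡ G
  uncurry-injective {F = F} {G} eq =
    trans (sym (curry-η F)) (trans (cong curry eq) (curry-η G))

  transpose : ∀ {X A B} → (X ⊗₀ A) ⇒ B → A ⇒ (X ⊸ B)
  transpose k = curry (k ∘ σ)

  transpose-∘ : ∀ {W X A B} (k : (X ⊗₀ A) ⇒ B) (a : W ⇒ A) →
                transpose k ∘ a ≡ transpose (k ∘ (id ⊗₁ a))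
  transpose-∘ k a = begin
    curry (k ∘ σ) ∘ a              ≡⟨ curry-∘ (k ∘ σ) a ⟩
    curry ((k ∘ σ) ∘ (a ⊗₁ id))    ≡⟨ cong curry (assoc k σ (a ⊗₁ id)) ⟩
    curry (k ∘ σ ∘ (a ⊗₁ id))      ≡⟨ cong (λ u → curry (k ∘ u)) (σ-nat a id) ⟩
    curry (k ∘ (id ⊗₁ a) ∘ σ)      ≡⟨ cong curry (sym (assoc k (id ⊗₁ a) σ)) ⟩
    curry ((k ∘ (id ⊗₁ a)) ∘ σ)    ∎

  transpose-injective : ∀ {X A B} {k l : (X ⊗₀ A) ⇒ B} → transpose k ≡ transpose l → k ≡ l
  transpose-injective eq = ∘-cancel-split-epiʳ σ-inv (curry-injective eq)

module SummationObjectProperties {o h} (C : SMCC o h) (Z : ZeroMorphisms C)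
                                 (SO : SummationObject C Z) where
  open SMCC C
  open ClosedCategory C
  open SummationObject SO
  open SumObj C Z SO
  open ≡-Reasoning

  -- πD i = evAt (ι i) and ΣD = evAt Δ definitionally.
  evAt : 𝟙 ⇒ D → ∀ {Y} → D⊸₀ Y ⇒ Y
  evAt p = ev ∘ (id ⊗₁ p) ∘ ρ⁻¹

  evAt-uncurry : ∀ {X Y} (p : 𝟙 ⇒ D) (G : X ⇒ D⊸₀ Y) →
                 evAt p ∘ G ≡ uncurry G ∘ (id ⊗₁ p) ∘ ρ⁻¹
  evAt-uncurry p G = begin
    (ev ∘ (id ⊗₁ p) ∘ ρ⁻¹) ∘ G         ≡⟨ assoc ev _ G ⟩
    ev ∘ ((id ⊗₁ p) ∘ ρ⁻¹) ∘ G         ≡⟨ cong (ev ∘_) (assoc (id ⊗₁ p) ρ⁻¹ G) ⟩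
    ev ∘ (id ⊗₁ p) ∘ ρ⁻¹ ∘ G           ≡⟨ cong (λ u → ev ∘ (id ⊗₁ p) ∘ u) (ρ⁻¹-natural G) ⟩
    ev ∘ (id ⊗₁ p) ∘ (G ⊗₁ id) ∘ ρ⁻¹   ≡⟨ cong (ev ∘_) (sym (assoc (id ⊗₁ p) (G ⊗₁ id) ρ⁻¹)) ⟩
    ev ∘ ((id ⊗₁ p) ∘ (G ⊗₁ id)) ∘ ρ⁻¹ ≡⟨ cong (λ u → ev ∘ u ∘ ρ⁻¹) (sym (serialize₂₁ G p)) ⟩
    ev ∘ (G ⊗₁ p) ∘ ρ⁻¹                ≡⟨ cong (λ u → ev ∘ u ∘ ρ⁻¹) (serialize₁₂ G p) ⟩
    ev ∘ ((G ⊗₁ id) ∘ (id ⊗₁ p)) ∘ ρ⁻¹ ≡⟨ cong (ev ∘_) (assoc (G ⊗₁ id) (id ⊗₁ p) ρ⁻¹) ⟩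
    ev ∘ (G ⊗₁ id) ∘ (id ⊗₁ p) ∘ ρ⁻¹   ≡⟨ sym (assoc ev (G ⊗₁ id) _) ⟩
    uncurry G ∘ (id ⊗₁ p) ∘ ρ⁻¹        ∎

  evAt-uncurry-∘ : ∀ {W X A Y} (p : 𝟙 ⇒ D) (G : A ⇒ D⊸₀ Y) (a : X ⇒ A) (r : W ⇒ X) →
                   evAt p ∘ G ∘ a ∘ r ≡ uncurry G ∘ (a ⊗₁ p) ∘ ρ⁻¹ ∘ r
  evAt-uncurry-∘ p G a r = begin
    evAt p ∘ G ∘ a ∘ r                               ≡⟨ evAt-uncurry p (G ∘ a ∘ r) ⟩
    uncurry (G ∘ a ∘ r) ∘ (id ⊗₁ p) ∘ ρ⁻¹            ≡⟨ cong (_∘ (id ⊗₁ p) ∘ ρ⁻¹) (uncurry-∘ G (a ∘ r)) ⟩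
    (uncurry G ∘ ((a ∘ r) ⊗₁ id)) ∘ (id ⊗₁ p) ∘ ρ⁻¹  ≡⟨ assoc (uncurry G) _ _ ⟩
    uncurry G ∘ ((a ∘ r) ⊗₁ id) ∘ (id ⊗₁ p) ∘ ρ⁻¹    ≡⟨ cong (uncurry G ∘_) (⊗-point-slide a r p) ⟩
    uncurry G ∘ (a ⊗₁ p) ∘ ρ⁻¹ ∘ r                   ∎

  D⊸-identity : ∀ {X} → D⊸₁ (id {X}) ≡ id
  D⊸-identity = begin
    curry (id ∘ ev)           ≡⟨ cong curry (identityˡ ev) ⟩
    curry ev                  ≡⟨ cong curry (sym (trans (cong (ev ∘_) ⊗-id) (identityʳ ev))) ⟩
    curry (uncurry id)        ≡⟨ curry-η id ⟩
    id                        ∎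

  D⊸-homomorphism : ∀ {X Y W} (f : Y ⇒ W) (g : X ⇒ Y) → D⊸₁ (f ∘ g) ≡ D⊸₁ f ∘ D⊸₁ g
  D⊸-homomorphism f g = sym (begin
    curry (f ∘ ev) ∘ D⊸₁ g               ≡⟨ curry-∘ (f ∘ ev) (D⊸₁ g) ⟩
    curry ((f ∘ ev) ∘ (D⊸₁ g ⊗₁ id))     ≡⟨ cong curry (assoc f ev (D⊸₁ g ⊗₁ id)) ⟩
    curry (f ∘ uncurry (curry (g ∘ ev))) ≡⟨ cong (λ u → curry (f ∘ u)) (curry-β (g ∘ ev)) ⟩
    curry (f ∘ g ∘ ev)                   ≡⟨ cong curry (sym (assoc f g ev)) ⟩
    curry ((f ∘ g) ∘ ev)                 ∎)

  evAt-natural : ∀ {X Y} (p : 𝟙 ⇒ D) (f : X ⇒ Y) → evAt p ∘ D⊸₁ f ≡ f ∘ evAt p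
  evAt-natural p f = begin
    evAt p ∘ D⊸₁ f                             ≡⟨ evAt-uncurry p (D⊸₁ f) ⟩
    uncurry (curry (f ∘ ev)) ∘ (id ⊗₁ p) ∘ ρ⁻¹ ≡⟨ cong (_∘ (id ⊗₁ p) ∘ ρ⁻¹) (curry-β (f ∘ ev)) ⟩
    (f ∘ ev) ∘ (id ⊗₁ p) ∘ ρ⁻¹                 ≡⟨ assoc f ev _ ⟩
    f ∘ evAt p                                 ∎

  evAt-ι-jointly-monic : ∀ {X Y : Obj} (f g : X ⇒ D⊸₀ Y) →
                         (∀ i → evAt (ι i) ∘ f ≡ evAt (ι i) ∘ g) → f ≡ g
  evAt-ι-jointly-monic {X} {Y} f g eq = uncurry-injective (transpose-injective
    (ι-jointly-epic (transpose (uncurry f)) (transpose (uncurry g)) λ i → begin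
      transpose (uncurry f) ∘ ι i            ≡⟨ transpose-∘ (uncurry f) (ι i) ⟩
      transpose (uncurry f ∘ (id ⊗₁ ι i))    ≡⟨ cong transpose (uncurry-at-ι i) ⟩
      transpose (uncurry g ∘ (id ⊗₁ ι i))    ≡⟨ sym (transpose-∘ (uncurry g) (ι i)) ⟩
      transpose (uncurry g) ∘ ι i            ∎))
    where
    evAt-as-uncurry : ∀ i (F : X ⇒ D⊸₀ Y) → evAt (ι i) ∘ F ≡ (uncurry F ∘ (id ⊗₁ ι i)) ∘ ρ⁻¹
    evAt-as-uncurry i F = trans (evAt-uncurry (ι i) F) (sym (assoc (uncurry F) _ ρ⁻¹))

    uncurry-at-ι : ∀ i → uncurry f ∘ (id ⊗₁ ι i) ≡ uncurry g ∘ (id ⊗₁ ι i)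
    uncurry-at-ι i = ∘-cancel-split-epiʳ ρ-isoˡ
      (trans (sym (evAt-as-uncurry i f)) (trans (eq i) (evAt-as-uncurry i g)))

  uncurryⁿ : ∀ n {X Y} → X ⇒ iterObj C Z D⊸₀ n Y → XD X n ⇒ Y
  uncurryⁿ zero g = g
  uncurryⁿ (suc n) g = uncurry (uncurryⁿ n g)

  curryⁿ : ∀ n {X Y} → XD X n ⇒ Y → X ⇒ iterObj C Z D⊸₀ n Y
  curryⁿ zero k = k
  curryⁿ (suc n) k = curryⁿ n (curry k)

  uncurryⁿ-curryⁿ : ∀ n {X Y} (k : XD X n ⇒ Y) → uncurryⁿ n (curryⁿ n k) ≡ k
  uncurryⁿ-curryⁿ zero k = refl
  uncurryⁿ-curryⁿ (suc n) k = trans (cong uncurry (uncurryⁿ-curryⁿ n (curry k))) (curry-β k)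

  πs-uncurryⁿ : ∀ n {X Y} (is : Vec ℕ n) (g : X ⇒ iterObj C Z D⊸₀ n Y) →
                πs C Z D⊸₀ πD is ∘ g ≡ uncurryⁿ n g ∘ ιs is ∘ ρⁿ⁻¹ n
  πs-uncurryⁿ zero [] g = id∘f≡f∘id∘id g
  πs-uncurryⁿ (suc n) {Y = Y} (i ∷ is) g = begin
    (πD i Y ∘ πs C Z D⊸₀ πD is) ∘ g         ≡⟨ assoc (πD i Y) _ g ⟩
    evAt (ι i) ∘ πs C Z D⊸₀ πD is ∘ g       ≡⟨ cong (evAt (ι i) ∘_) (πs-uncurryⁿ n is g) ⟩
    evAt (ι i) ∘ uncurryⁿ n g ∘ ιs is ∘ ρⁿ⁻¹ n ≡⟨ evAt-uncurry-∘ (ι i) (uncurryⁿ n g) (ιs is) (ρⁿ⁻¹ n) ⟩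
    uncurryⁿ (suc n) g ∘ (ιs is ⊗₁ ι i) ∘ ρ⁻¹ ∘ ρⁿ⁻¹ n ∎

  Σs-uncurryⁿ : ∀ n {X Y} (g : X ⇒ iterObj C Z D⊸₀ n Y) →
                Σs C Z D⊸₀ ΣD n ∘ g ≡ uncurryⁿ n g ∘ Δs n ∘ ρⁿ⁻¹ n
  Σs-uncurryⁿ zero g = id∘f≡f∘id∘id g
  Σs-uncurryⁿ (suc n) {Y = Y} g = begin
    (ΣD Y ∘ Σs C Z D⊸₀ ΣD n) ∘ g            ≡⟨ assoc (ΣD Y) _ g ⟩
    evAt Δ ∘ Σs C Z D⊸₀ ΣD n ∘ g            ≡⟨ cong (evAt Δ ∘_) (Σs-uncurryⁿ n g) ⟩
    evAt Δ ∘ uncurryⁿ n g ∘ Δs n ∘ ρⁿ⁻¹ n   ≡⟨ evAt-uncurry-∘ Δ (uncurryⁿ n g) (Δs n) (ρⁿ⁻¹ n) ⟩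
    uncurryⁿ (suc n) g ∘ (Δs n ⊗₁ Δ) ∘ ρ⁻¹ ∘ ρⁿ⁻¹ n ∎

  Σs-curryⁿ : ∀ n {X Y} (k : XD X n ⇒ Y) → Σs C Z D⊸₀ ΣD n ∘ curryⁿ n k ≡ k ∘ Δs n ∘ ρⁿ⁻¹ n
  Σs-curryⁿ n k =
    trans (Σs-uncurryⁿ n (curryⁿ n k)) (cong (_∘ Δs n ∘ ρⁿ⁻¹ n) (uncurryⁿ-curryⁿ n k))

  Represents : ∀ {n X Y} → X ⇒ iterObj C Z D⊸₀ n Y → (Vec ℕ n → X ⇒ Y) → Set h
  Represents g f = ∀ is → πs C Z D⊸₀ πD is ∘ g ≡ f is

  TensorRepresents : ∀ {n X Y} → XD X n ⇒ Y → (Vec ℕ n → X ⇒ Y) → Set h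
  TensorRepresents {n} k f = ∀ is → k ∘ ιs is ∘ ρⁿ⁻¹ n ≡ f is

  uncurryⁿ-represents : ∀ {n X Y} {f : Vec ℕ n → X ⇒ Y} (g : X ⇒ iterObj C Z D⊸₀ n Y) →
                        Represents g f → TensorRepresents (uncurryⁿ n g) f
  uncurryⁿ-represents {n} g g-rep is = trans (sym (πs-uncurryⁿ n is g)) (g-rep is)

  curryⁿ-represents : ∀ {n X Y} {f : Vec ℕ n → X ⇒ Y} (k : XD X n ⇒ Y) →
                      TensorRepresents k f → Represents (curryⁿ n k) f
  curryⁿ-represents {n} {f = f} k k-rep is = begin
    πs C Z D⊸₀ πD is ∘ curryⁿ n k                ≡⟨ πs-uncurryⁿ n is (curryⁿ n k) ⟩
    uncurryⁿ n (curryⁿ n k) ∘ ιs is ∘ ρⁿ⁻¹ n      ≡⟨ cong (_∘ ιs is ∘ ρⁿ⁻¹ n) (uncurryⁿ-curryⁿ n k) ⟩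
    k ∘ ιs is ∘ ρⁿ⁻¹ n                           ≡⟨ k-rep is ⟩
    f is                                         ∎

  represented⇔tensor-represented :
    ∀ {n X Y} (f : Vec ℕ n → X ⇒ Y) →
    (Σ[ g ∈ X ⇒ iterObj C Z D⊸₀ n Y ] Represents g f) ⇔ (Σ[ k ∈ XD X n ⇒ Y ] TensorRepresents k f)
  represented⇔tensor-represented {n} f = mk⇔
    (λ (g , g-rep) → uncurryⁿ n g , uncurryⁿ-represents g g-rep)
    (λ (k , k-rep) → curryⁿ n k , curryⁿ-represents k k-rep)

proposition6p4 : ∀ {o h : Level} (C : SMCC o h) (Z : ZeroMorphisms C) →
    Absorbing C Z → Representable C Z ⇔ HasTensorialSums C Z
proposition6p4 C Z _ = mk⇔ tensorial representable
  where
  open SummationObjectProperties C Z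

  tensorial : Representable C Z → HasTensorialSums C Z
  tensorial (SO , S) = SO , pcm
    , (λ n f → ⇔-trans (summable-iff n f) (represented⇔tensor-represented SO f))
    , (λ n f k k-rep s s-sums →
         trans (sum-eq n f (curryⁿ SO (suc n) k) (curryⁿ-represents SO k k-rep) s s-sums)
               (Σs-curryⁿ SO (suc n) k))
    , empty-sum
    where open IsSummabilityStructure S

  representable : HasTensorialSums C Z → Representable C Z
  representable (SO , pcm , summable⇔ , sum≡ , empty-sum) = SO , record
    { S-id = D⊸-identity SO
    ; S-∘ = D⊸-homomorphism SO
    ; π-nat = λ i → evAt-natural SO (SummationObject.ι SO i)
    ; Σ-nat = evAt-natural SO (SummationObject.Δ SO)
    ; π-jointly-monic = evAt-ι-jointly-monic SO
    ; pcm = pcm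
    ; summable-iff = λ n f →
        ⇔-trans (summable⇔ n f) (⇔-sym (represented⇔tensor-represented SO f))
    ; sum-eq = λ n f g g-rep s s-sums →
        trans (sum≡ n f (uncurryⁿ SO (suc n) g) (uncurryⁿ-represents SO g g-rep) s s-sums)
              (sym (Σs-uncurryⁿ SO (suc n) g))
    ; empty-sum = empty-sum
    }
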